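{- Let $G,H$ be finite alphabets, $S\subseteq G^n$, and $f:S\to H$ a non-constant partial function. Then $\mathrm{CA}(f)=\mathrm{WA}(f)$.
   Context: For $x\in S$, $x_i$ is its $i$-th letter. Relational adversary: for $R:S\times S\to\mathbb{R}_{\ge0}$, not identically zero, symmetric, with $R(x,y)=0$ whenever $f(x)=f(y)$, let $\theta(x,i)=\frac{\sum_{y\in S}R(x,y)}{\sum_{y\in S:x_i\neq y_i}R(x,y)}$ (undefined if the denominator is 0); $\mathrm{CA}(f)=\max_R\min\{\max\{\theta(x,i),\theta(y,i)\}: x,y\in S, i\in[n], R(x,y)>0, x_i\neq y_i\}$. Weighted adversary: weights $w(x,y)=w(y,x)\ge0$ on $S^2$ with $w(x,y)=0$ whenever $f(x)=f(y)$, and $w'(x,y,i)\ge0$ with $w'(x,y,i)=0$ whenever $x_i=y_i$ or $f(x)=f(y)$, and $w'(x,y,i),w'(y,x,i)\ge w(x,y)$ whenever $x_i\neq y_i$. Set $wt(x)=\sum_y w(x,y)$, $v(x,i)=\sum_y w'(x,y,i)$, and $\mathrm{WA}(f)=\max_{w,w'}\min\{\max\{wt(x)/v(x,i),wt(y)/v(y,i)\}: w(x,y)\neq0, x_i\neq y_i\}$.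
   Formalization: The weights R of the relational adversary and the weights w, w′ of the weighted adversary take nonnegative rational values instead of values in $\mathbb{R}_{\ge0}$. -}

module Defs where

open import Data.Nat using (ℕ; zero; suc)
open import Data.Fin using (Fin; zero; suc)
open import Data.Vec using (Vec; lookup)
open import Data.Rational using (ℚ; 0ℚ; _+_; _÷_; _⊔_; _≤_; _<_; ≢-nonZero)
open import Data.Rational.Properties using (_≟_)
open import Data.Product using (Σ; ∃; ∃-syntax; _×_)
open import Function.Definitions using (Injective)
open import Relation.Binary.PropositionalEquality using (_≡_; _≢_)
open import Relation.Nullary using (¬_; yes; no)
import Data.Fin as F

sumFin : ∀ {m} → (Fin m → ℚ) → ℚ
sumFin {zero}  φ = 0ℚ
sumFin {suc m} φ = φ zero + sumFin (λ j → φ (suc j))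

-- Division; only ever used with a nonzero denominator in the theorem
-- (the value for denominator 0 is irrelevant, set to 0).
div : ℚ → ℚ → ℚ
div p q with q ≟ 0ℚ
... | yes _  = 0ℚ
... | no q≢0 = _÷_ p q {{≢-nonZero q≢0}}

-- Setting: alphabets G = Fin g, H = Fin h; S ⊆ G^n is given as the image of
-- an injective enumeration s : Fin m → Vec (Fin g) n; f : S → H is f : Fin m → Fin h.
module Adversary {g h n m : ℕ} (s : Fin m → Vec (Fin g) n) (f : Fin m → Fin h) where

  letter : Fin m → Fin n → Fin g
  letter x i = lookup (s x) i

  ifDiff : Fin m → Fin m → Fin n → ℚ → ℚ
  ifDiff x y i q with letter x i F.≟ letter y i
  ... | yes _ = 0ℚ
  ... | no _  = q

  record IsRelational (R : Fin m → Fin m → ℚ) : Set where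
    field
      nonneg    : ∀ x y → 0ℚ ≤ R x y
      symmetric : ∀ x y → R x y ≡ R y x
      zeroSame  : ∀ x y → f x ≡ f y → R x y ≡ 0ℚ
      nonzero   : ∃[ x ] ∃[ y ] R x y ≢ 0ℚ

  θ : (Fin m → Fin m → ℚ) → Fin m → Fin n → ℚ
  θ R x i = div (sumFin (λ y → R x y)) (sumFin (λ y → ifDiff x y i (R x y)))

  -- the index set of the min in CA
  CAIndex : (Fin m → Fin m → ℚ) → Fin m → Fin m → Fin n → Set
  CAIndex R x y i = (0ℚ < R x y) × (letter x i ≢ letter y i)

  -- the quantity under the min in CA
  CAObj : (Fin m → Fin m → ℚ) → Fin m → Fin m → Fin n → ℚ
  CAObj R x y i = θ R x i ⊔ θ R y i

  record IsWeighted (w : Fin m → Fin m → ℚ) (w′ : Fin m → Fin m → Fin n → ℚ) : Set where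
    field
      w-nonneg    : ∀ x y → 0ℚ ≤ w x y
      w-symmetric : ∀ x y → w x y ≡ w y x
      w-zeroSame  : ∀ x y → f x ≡ f y → w x y ≡ 0ℚ
      w-nonzero   : ∃[ x ] ∃[ y ] w x y ≢ 0ℚ
      w′-nonneg   : ∀ x y i → 0ℚ ≤ w′ x y i
      w′-zeroEq   : ∀ x y i → letter x i ≡ letter y i → w′ x y i ≡ 0ℚ
      w′-zeroSame : ∀ x y i → f x ≡ f y → w′ x y i ≡ 0ℚ
      w′-bound    : ∀ x y i → letter x i ≢ letter y i → (w x y ≤ w′ x y i) × (w x y ≤ w′ y x i)

  wt : (Fin m → Fin m → ℚ) → Fin m → ℚ
  wt w x = sumFin (λ y → w x y)

  v : (Fin m → Fin m → Fin n → ℚ) → Fin m → Fin n → ℚ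
  v w′ x i = sumFin (λ y → w′ x y i)

  WAIndex : (Fin m → Fin m → ℚ) → Fin m → Fin m → Fin n → Set
  WAIndex w x y i = (w x y ≢ 0ℚ) × (letter x i ≢ letter y i)

  WAObj : (Fin m → Fin m → ℚ) → (Fin m → Fin m → Fin n → ℚ) → Fin m → Fin m → Fin n → ℚ
  WAObj w w′ x y i = div (wt w x) (v w′ x i) ⊔ div (wt w y) (v w′ y i)

  -- Comparison of the objective values (min over the index sets).
  -- CAval R ≤ WAval w w′  iff every WA-term dominates some CA-term.
  CA≤WA : (Fin m → Fin m → ℚ) → (Fin m → Fin m → ℚ) → (Fin m → Fin m → Fin n → ℚ) → Set
  CA≤WA R w w′ = ∀ x y i → WAIndex w x y i →
    ∃[ x₀ ] ∃[ y₀ ] ∃[ i₀ ] (CAIndex R x₀ y₀ i₀ × (CAObj R x₀ y₀ i₀ ≤ WAObj w w′ x y i))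

  WA≤CA : (Fin m → Fin m → ℚ) → (Fin m → Fin m → Fin n → ℚ) → (Fin m → Fin m → ℚ) → Set
  WA≤CA w w′ R = ∀ x y i → CAIndex R x y i →
    ∃[ x₀ ] ∃[ y₀ ] ∃[ i₀ ] (WAIndex w x₀ y₀ i₀ × (WAObj w w′ x₀ y₀ i₀ ≤ CAObj R x y i))

  -- CA(f) = WA(f): every relational adversary is matched by a weighted one
  -- of at least the same value, and vice versa (both maxima then coincide).
  CA≡WA : Set
  CA≡WA =
    (∀ R → IsRelational R → ∃[ w ] ∃[ w′ ] (IsWeighted w w′ × CA≤WA R w w′))
    × (∀ w w′ → IsWeighted w w′ → ∃[ R ] (IsRelational R × WA≤CA w w′ R))

{-# OPTIONS --safe #-}
-- A relational adversary R is the weighted adversary w = R, w′(x,y,i) = R(x,y)·[x_i ≠ y_i],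
-- and then wt(x)/v(x,i) is literally θ(x,i), so both objectives agree term by term.
-- Conversely a weighted adversary (w, w′) yields the relational adversary R = w: the bound
-- w′(x,y,i) ≥ w(x,y) on differing letters gives v(x,i) ≥ Σ_{y : x_i ≠ y_i} w(x,y), hence
-- wt(x)/v(x,i) ≤ θ(x,i) wherever the WA term is defined.
module Submission where

open import Defs
open import Data.Nat using (ℕ; zero; suc)
open import Data.Fin using (Fin; zero; suc)
open import Data.Vec using (Vec)
open import Data.Product using (∃-syntax; _,_; proj₁)
open import Function.Definitions using (Injective)
open import Relation.Binary.PropositionalEquality using (_≡_; _≢_; refl; sym; trans; cong; subst; ≢-sym)
open import Relation.Nullary using (yes; no; contradiction)
open import Data.Rational
  using (ℚ; 0ℚ; 1ℚ; _+_; _*_; _÷_; _≤_; _<_; 1/_; NonZero; NonNegative; Positive; positive; nonNegative; ≢-nonZero)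
open import Data.Rational.Properties
import Data.Fin as F

≤∧≢⇒< : ∀ {p q : ℚ} → p ≤ q → p ≢ q → p < q
≤∧≢⇒< {p} {q} p≤q p≢q with q ≤? p
... | yes q≤p = contradiction (≤-antisym p≤q q≤p) p≢q
... | no  q≰p = ≰⇒> q≰p

1/-antimono-≤ : ∀ {p q} .{{_ : NonZero p}} .{{_ : NonZero q}} → 0ℚ < p → p ≤ q → 1/ q ≤ 1/ p
1/-antimono-≤ {p} {q} 0<p p≤q = begin
  1/ q              ≡⟨ *-identityʳ (1/ q) ⟨
  1/ q * 1ℚ         ≡⟨ cong (1/ q *_) (*-inverseʳ p) ⟨
  1/ q * (p * 1/ p) ≡⟨ *-assoc (1/ q) p (1/ p) ⟨
  1/ q * p * 1/ p   ≤⟨ *-monoʳ-≤-nonNeg (1/ p) (*-monoˡ-≤-nonNeg (1/ q) p≤q) ⟩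
  1/ q * q * 1/ p   ≡⟨ cong (_* 1/ p) (*-inverseˡ q) ⟩
  1ℚ * 1/ p         ≡⟨ *-identityˡ (1/ p) ⟩
  1/ p              ∎
  where
  open ≤-Reasoning
  1/p>0 : Positive (1/ p)
  1/p>0 = 1/pos⇒pos p {{positive 0<p}}
  1/q>0 : Positive (1/ q)
  1/q>0 = 1/pos⇒pos q {{positive (<-≤-trans 0<p p≤q)}}
  instance
    1/p≥0 : NonNegative (1/ p)
    1/p≥0 = pos⇒nonNeg (1/ p) {{1/p>0}}
    1/q≥0 : NonNegative (1/ q)
    1/q≥0 = pos⇒nonNeg (1/ q) {{1/q>0}}

div-≢0 : ∀ p {q} (q≢0 : q ≢ 0ℚ) → div p q ≡ (p ÷ q) {{≢-nonZero q≢0}}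
div-≢0 p {q} q≢0 with q ≟ 0ℚ
... | yes q≡0 = contradiction q≡0 q≢0
... | no  _   = refl

div-antimonoʳ-≤ : ∀ {p q r} → 0ℚ ≤ p → 0ℚ < q → q ≤ r → div p r ≤ div p q
div-antimonoʳ-≤ {p} {q} {r} 0≤p 0<q q≤r = begin
  div p r  ≡⟨ div-≢0 p r≢0 ⟩
  p * 1/ r ≤⟨ *-monoˡ-≤-nonNeg p {{nonNegative 0≤p}} (1/-antimono-≤ 0<q q≤r) ⟩
  p * 1/ q ≡⟨ div-≢0 p q≢0 ⟨
  div p q  ∎
  where
  open ≤-Reasoning
  q≢0 : q ≢ 0ℚ
  q≢0 = ≢-sym (<⇒≢ 0<q)
  r≢0 : r ≢ 0ℚ
  r≢0 = ≢-sym (<⇒≢ (<-≤-trans 0<q q≤r))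
  instance
    _ = ≢-nonZero q≢0
    _ = ≢-nonZero r≢0

sumFin-nonneg : ∀ {m} (φ : Fin m → ℚ) → (∀ j → 0ℚ ≤ φ j) → 0ℚ ≤ sumFin φ
sumFin-nonneg {zero}  φ φ≥0 = ≤-refl
sumFin-nonneg {suc m} φ φ≥0 =
  +-mono-≤ (φ≥0 zero) (sumFin-nonneg (λ j → φ (suc j)) (λ j → φ≥0 (suc j)))

sumFin-mono-≤ : ∀ {m} {φ ψ : Fin m → ℚ} → (∀ j → φ j ≤ ψ j) → sumFin φ ≤ sumFin ψ
sumFin-mono-≤ {zero}  φ≤ψ = ≤-refl
sumFin-mono-≤ {suc m} φ≤ψ = +-mono-≤ (φ≤ψ zero) (sumFin-mono-≤ (λ j → φ≤ψ (suc j)))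

≤-sumFin : ∀ {m} (φ : Fin m → ℚ) → (∀ j → 0ℚ ≤ φ j) → ∀ k → φ k ≤ sumFin φ
≤-sumFin {suc m} φ φ≥0 zero = begin
  φ zero                               ≡⟨ +-identityʳ (φ zero) ⟨
  φ zero + 0ℚ                          ≤⟨ +-monoʳ-≤ (φ zero) (sumFin-nonneg (λ j → φ (suc j)) (λ j → φ≥0 (suc j))) ⟩
  φ zero + sumFin (λ j → φ (suc j))    ∎
  where open ≤-Reasoning
≤-sumFin {suc m} φ φ≥0 (suc k) = begin
  φ (suc k)                            ≡⟨ +-identityˡ (φ (suc k)) ⟨
  0ℚ + φ (suc k)                       ≤⟨ +-mono-≤ (φ≥0 zero) (≤-sumFin (λ j → φ (suc j)) (λ j → φ≥0 (suc j)) k) ⟩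
  φ zero + sumFin (λ j → φ (suc j))    ∎
  where open ≤-Reasoning

module _ {g h n m : ℕ} (s : Fin m → Vec (Fin g) n) (f : Fin m → Fin h) where
  open Adversary s f

  ifDiff-≡ : ∀ {x y i} q → letter x i ≡ letter y i → ifDiff x y i q ≡ 0ℚ
  ifDiff-≡ {x} {y} {i} q xᵢ≡yᵢ with letter x i F.≟ letter y i
  ... | yes _     = refl
  ... | no  xᵢ≢yᵢ = contradiction xᵢ≡yᵢ xᵢ≢yᵢ

  ifDiff-≢ : ∀ {x y i} q → letter x i ≢ letter y i → ifDiff x y i q ≡ q
  ifDiff-≢ {x} {y} {i} q xᵢ≢yᵢ with letter x i F.≟ letter y i
  ... | yes xᵢ≡yᵢ = contradiction xᵢ≡yᵢ xᵢ≢yᵢ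
  ... | no  _     = refl

  ifDiff-0 : ∀ x y i → ifDiff x y i 0ℚ ≡ 0ℚ
  ifDiff-0 x y i with letter x i F.≟ letter y i
  ... | yes _ = refl
  ... | no  _ = refl

  ifDiff-nonneg : ∀ x y i {q} → 0ℚ ≤ q → 0ℚ ≤ ifDiff x y i q
  ifDiff-nonneg x y i 0≤q with letter x i F.≟ letter y i
  ... | yes _ = ≤-refl
  ... | no  _ = 0≤q

  ifDiff-≤ : ∀ x y i {q r} → 0ℚ ≤ r → (letter x i ≢ letter y i → q ≤ r) → ifDiff x y i q ≤ r
  ifDiff-≤ x y i 0≤r q≤r with letter x i F.≟ letter y i
  ... | yes _     = 0≤r
  ... | no  xᵢ≢yᵢ = q≤r xᵢ≢yᵢ

  restrictToDiff : (Fin m → Fin m → ℚ) → Fin m → Fin m → Fin n → ℚ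
  restrictToDiff R x y i = ifDiff x y i (R x y)

  relational⇒weighted : ∀ {R} → IsRelational R → IsWeighted R (restrictToDiff R)
  relational⇒weighted {R} isR = record
    { w-nonneg    = nonneg
    ; w-symmetric = symmetric
    ; w-zeroSame  = zeroSame
    ; w-nonzero   = nonzero
    ; w′-nonneg   = λ x y i → ifDiff-nonneg x y i (nonneg x y)
    ; w′-zeroEq   = λ x y i → ifDiff-≡ (R x y)
    ; w′-zeroSame = λ x y i fx≡fy → trans (cong (ifDiff x y i) (zeroSame x y fx≡fy)) (ifDiff-0 x y i)
    ; w′-bound    = λ x y i xᵢ≢yᵢ →
        ≤-reflexive (sym (ifDiff-≢ (R x y) xᵢ≢yᵢ)) ,
        ≤-reflexive (trans (symmetric x y) (sym (ifDiff-≢ (R y x) (≢-sym xᵢ≢yᵢ))))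
    }
    where open IsRelational isR

  weighted⇒relational : ∀ {w w′} → IsWeighted w w′ → IsRelational w
  weighted⇒relational isW = record
    { nonneg    = w-nonneg
    ; symmetric = w-symmetric
    ; zeroSame  = w-zeroSame
    ; nonzero   = w-nonzero
    }
    where open IsWeighted isW

  CA≤WA-restrictToDiff : ∀ {R} → IsRelational R → CA≤WA R R (restrictToDiff R)
  CA≤WA-restrictToDiff isR x y i (Rxy≢0 , xᵢ≢yᵢ) =
    x , y , i , (≤∧≢⇒< (nonneg x y) (≢-sym Rxy≢0) , xᵢ≢yᵢ) , ≤-refl
    where open IsRelational isR

  wt/v≤θ : ∀ {w w′ x y i} → IsWeighted w w′ → 0ℚ < w x y → letter x i ≢ letter y i →
           div (wt w x) (v w′ x i) ≤ θ w x i
  wt/v≤θ {w} {w′} {x} {y} {i} isW 0<wxy xᵢ≢yᵢ =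
    div-antimonoʳ-≤ (sumFin-nonneg (w x) (w-nonneg x)) 0<diffSum diffSum≤v
    where
    open IsWeighted isW
    diff : Fin m → ℚ
    diff = λ z → restrictToDiff w x z i
    diff-nonneg : ∀ z → 0ℚ ≤ diff z
    diff-nonneg z = ifDiff-nonneg x z i (w-nonneg x z)
    0<diffSum : 0ℚ < sumFin diff
    0<diffSum = begin-strict
      0ℚ         <⟨ 0<wxy ⟩
      w x y      ≡⟨ ifDiff-≢ (w x y) xᵢ≢yᵢ ⟨
      diff y     ≤⟨ ≤-sumFin diff diff-nonneg y ⟩
      sumFin diff ∎
      where open ≤-Reasoning
    diffSum≤v : sumFin diff ≤ v w′ x i
    diffSum≤v = sumFin-mono-≤ λ z →
      ifDiff-≤ x z i (w′-nonneg x z i) (λ xᵢ≢zᵢ → proj₁ (w′-bound x z i xᵢ≢zᵢ))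

  WA≤CA-self : ∀ {w w′} → IsWeighted w w′ → WA≤CA w w′ w
  WA≤CA-self {w} isW x y i (0<wxy , xᵢ≢yᵢ) =
    x , y , i , (≢-sym (<⇒≢ 0<wxy) , xᵢ≢yᵢ) ,
    ⊔-mono-≤ (wt/v≤θ isW 0<wxy xᵢ≢yᵢ)
             (wt/v≤θ isW (subst (0ℚ <_) (w-symmetric x y) 0<wxy) (≢-sym xᵢ≢yᵢ))
    where open IsWeighted isW

proposition3 : (g h n m : ℕ) (s : Fin m → Vec (Fin g) n) → Injective _≡_ _≡_ s →
    (f : Fin m → Fin h) → (∃[ a ] ∃[ b ] f a ≢ f b) →
    Adversary.CA≡WA s f
proposition3 g h n m s _ f _ =
    (λ R isR → R , restrictToDiff s f R , relational⇒weighted s f isR , CA≤WA-restrictToDiff s f isR)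
  , (λ w w′ isW → w , weighted⇒relational s f isW , WA≤CA-self s f isW)
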